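{- Let $h_1,\dots,h_k$ be positive integers. If an $\mathrm{LS}(h_1\dots h_k)$ exists, then for all pairwise disjoint subsets $A,B,C,D\subseteq[k]$ (possibly empty), with $E=A\cup B\cup C\cup D$ and $\overline{E}=[k]\setminus E$, $$\left(\sum_{i\in A\cup C}h_i\right)^2 + \left(\sum_{i\in B\cup D}h_i\right)^2 - \sum_{i\in E}h_i^2 \geq \left(\sum_{i\in A\cup D}h_i\right)\left(\sum_{i\in B\cup C}h_i - \sum_{j\in \overline{E}}h_j\right).$$
   Context: $[k]=\{1,\dots,k\}$; empty sums are $0$. For positive integers $h_1,\dots,h_k$ with $n=\sum_i h_i$, an $\mathrm{LS}(h_1\dots h_k)$ is a latin square of order $n$ containing $k$ pairwise disjoint subsquares of orders $h_1,\dots,h_k$. A subsquare of order $s$ is an $s\times s$ subarray which is itself a latin square; subsquares are disjoint if they share no rows, no columns and no symbols. -}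

module Defs where

open import Data.Nat using (ℕ; zero; suc; _+_; _*_; _≤_)
open import Data.Fin using (Fin; zero; suc)
open import Data.Fin.Subset using (Subset; _∈_; _∉_)
open import Data.Bool using (if_then_else_)
open import Data.Vec using (lookup)
open import Data.Product using (Σ; ∃; _×_)
open import Relation.Binary.PropositionalEquality using (_≡_; _≢_)
open import Function.Definitions using (Injective)

ΣFin : (k : ℕ) → (Fin k → ℕ) → ℕ
ΣFin zero    f = 0
ΣFin (suc k) f = f zero + ΣFin k (λ i → f (suc i))

ΣOver : {k : ℕ} → Subset k → (Fin k → ℕ) → ℕ
ΣOver {k} S f = ΣFin k (λ i → if lookup S i then f i else 0)

DisjointSets : {k : ℕ} → Subset k → Subset k → Set
DisjointSets {k} S T = (i : Fin k) → i ∈ S → i ∉ T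

Square : ℕ → Set
Square n = Fin n → Fin n → Fin n

-- Latin square of order n (symbols Fin n): each symbol at most (hence exactly)
-- once in every row and every column.
IsLatin : {n : ℕ} → Square n → Set
IsLatin {n} L =
  ((r : Fin n) → Injective _≡_ _≡_ (λ c → L r c)) ×
  ((c : Fin n) → Injective _≡_ _≡_ (λ r → L r c))

record Subsquare {n : ℕ} (L : Square n) (s : ℕ) : Set where
  field
    rows     : Fin s → Fin n
    cols     : Fin s → Fin n
    syms     : Fin s → Fin n
    rows-inj : Injective _≡_ _≡_ rows
    cols-inj : Injective _≡_ _≡_ cols
    syms-inj : Injective _≡_ _≡_ syms
    -- the subarray, read as an s×s array over the symbol set `syms`
    entry    : Fin s → Fin s → Fin s
    entry-ok : (i j : Fin s) → L (rows i) (cols j) ≡ syms (entry i j)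
    entry-latin : IsLatin entry

open Subsquare public

DisjointSub : {n s t : ℕ} {L : Square n} → Subsquare L s → Subsquare L t → Set
DisjointSub P Q =
  (∀ i j → rows P i ≢ rows Q j) ×
  (∀ i j → cols P i ≢ cols Q j) ×
  (∀ i j → syms P i ≢ syms Q j)

LS : (k : ℕ) → (Fin k → ℕ) → Set
LS k h =
  Σ (Square (ΣFin k h)) λ L →
  IsLatin L ×
  Σ ((p : Fin k) → Subsquare L (h p)) λ sq →
  ((p q : Fin k) → p ≢ q → DisjointSub (sq p) (sq q))

-- Since the orders add up to n, the subsquares partition the rows, the columns and the symbols, so
-- every row, column and symbol carries a label in [k]: the subsquare it belongs to.  Fix a kernel
-- U : [k] × [k] → ℤ and weigh the cell (r, c) holding σ by U(r, c) + U(c, σ) + U(σ, r), evaluated at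
-- the labels.  Every row and every column of a latin square contains each symbol exactly once, so each
-- of the three terms sums over all cells to Σ_{p,q} h_p h_q U(p, q).  If all cyclic sums
-- U(p, q) + U(q, s) + U(s, p) are nonnegative, discarding the cells outside the subsquares gives
-- Σ_p h_p² U(p, p) ≤ Σ_{p,q} h_p h_q U(p, q).  The theorem is this inequality for the kernel
--   U = 1_{A∪C} ⊗ 1_{A∪C} + 1_{B∪D} ⊗ 1_{B∪D} + 1_{A∪D} ⊗ 1_{[k]∖E} − 1_{B∪C} ⊗ 1_{A∪D},
-- whose diagonal is 1_E and whose cyclic sums are nonnegative: an index lies in exactly one of
-- A, B, C, D, [k]∖E, and the 125 resulting cases are checked by evaluation.

module Submission where

open import Data.Bool using (Bool; true; false; not; _∧_; _∨_; if_then_else_)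
open import Data.Fin using (Fin; zero; suc; splitAt; join; _↑ˡ_; _↑ʳ_; punchOut)
open import Data.Fin.Permutation using (permutation)
open import Data.Fin.Properties
  using (_≟_; any?; punchOut-injective; injective⇒≤; splitAt-↑ˡ; splitAt-↑ʳ; join-splitAt)
open import Data.Fin.Subset using (Subset; _∪_; ∁)
open import Data.Integer using (ℤ; +_; 0ℤ; 1ℤ; _+_; _-_; _*_; _≥_)
import Data.Integer as ℤ
open import Data.Integer.Properties
  using (+-*-semiring; *-commutativeSemigroup; +-mono-≤; +-monoʳ-≤; +-monoˡ-≤; +-identityʳ;
         +-identityˡ; +-assoc; ≤-refl; pos-+; pos-*; suc-*; *-distribˡ-+; *-assoc; *-identityʳ;
         *-zeroʳ; *-cancelˡ-≤-pos; i≤j⇒0≤j-i; module ≤-Reasoning)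
open import Data.Integer.Tactic.RingSolver using (solve-∀)
open import Data.List using (List; []; _∷_)
open import Data.List.Membership.Propositional using (_∈_)
open import Data.List.Relation.Unary.All using (All; []; _∷_; all?)
import Data.List.Relation.Unary.All as All
open import Data.List.Relation.Unary.Any using (here; there)
open import Data.Nat using (ℕ; zero; suc; _≤_)
import Data.Nat as ℕ
import Data.Nat.Properties as ℕ
open import Data.Product using (Σ-syntax; ∃; _×_; _,_; proj₁; proj₂; map)
open import Data.Sum using (inj₁; inj₂)
open import Data.Vec using (lookup)
open import Data.Vec.Properties using (lookup-zipWith; lookup-map; lookup⇒[]=)
open import Function using (_∘_; id; flip)
open import Function.Definitions using (Injective)
open import Relation.Binary.PropositionalEquality
open import Relation.Nullary using (yes; no; contradiction)
open import Relation.Nullary.Decidable using (from-yes)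

open import Defs
open import Algebra.Properties.Semiring.Sum +-*-semiring
  using (sum; sum-syntax; sum-cong-≗; ∑-distrib-+; ∑-comm; ∑-permute; *-distribˡ-sum; *-distribʳ-sum)
open import Algebra.Properties.CommutativeSemigroup *-commutativeSemigroup using (x∙yz≈y∙xz)

private variable
  k m : ℕ

∑-const : ∀ n x → ∑[ i < n ] x ≡ + n * x
∑-const zero    x = refl
∑-const (suc n) x = trans (cong (_+_ x) (∑-const n x)) (sym (suc-* (+ n) x))

∑-distrib-- : (f g : Fin m → ℤ) → ∑[ i < m ] (f i - g i) ≡ sum f - sum g
∑-distrib-- {zero}  f g = refl
∑-distrib-- {suc m} f g = trans (cong (_+_ (f zero - g zero)) (∑-distrib-- (f ∘ suc) (g ∘ suc)))
                                (interchange (f zero) (g zero) (sum (f ∘ suc)) (sum (g ∘ suc)))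
  where
  interchange : ∀ a b c d → a - b + (c - d) ≡ a + c - (b + d)
  interchange = solve-∀

∑-mono-≤ : {f g : Fin m → ℤ} → (∀ i → f i ℤ.≤ g i) → sum f ℤ.≤ sum g
∑-mono-≤ {zero}  f≤g = ≤-refl
∑-mono-≤ {suc m} f≤g = +-mono-≤ (f≤g zero) (∑-mono-≤ (f≤g ∘ suc))

∑-nonneg : {f : Fin m → ℤ} → (∀ i → 0ℤ ℤ.≤ f i) → 0ℤ ℤ.≤ sum f
∑-nonneg {zero}  0≤f = ≤-refl
∑-nonneg {suc m} 0≤f = +-mono-≤ (0≤f zero) (∑-nonneg (0≤f ∘ suc))

term≤∑ : {f : Fin m → ℤ} → (∀ i → 0ℤ ℤ.≤ f i) → ∀ i → f i ℤ.≤ sum f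
term≤∑ {f = f} 0≤f zero = begin
  f zero                  ≡⟨ +-identityʳ (f zero) ⟨
  f zero + 0ℤ             ≤⟨ +-monoʳ-≤ (f zero) (∑-nonneg (0≤f ∘ suc)) ⟩
  f zero + sum (f ∘ suc)  ∎
  where open ≤-Reasoning
term≤∑ {f = f} 0≤f (suc i) = begin
  f (suc i)               ≤⟨ term≤∑ (0≤f ∘ suc) i ⟩
  sum (f ∘ suc)           ≡⟨ +-identityˡ (sum (f ∘ suc)) ⟨
  0ℤ + sum (f ∘ suc)      ≤⟨ +-monoˡ-≤ (sum (f ∘ suc)) (0≤f zero) ⟩
  f zero + sum (f ∘ suc)  ∎
  where open ≤-Reasoning

∑-↑ : ∀ m n (F : Fin (m ℕ.+ n) → ℤ) → sum F ≡ ∑[ i < m ] F (i ↑ˡ n) + ∑[ j < n ] F (m ↑ʳ j)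
∑-↑ zero    n F = sym (+-identityˡ (sum F))
∑-↑ (suc m) n F = trans (cong (_+_ (F zero)) (∑-↑ m n (F ∘ suc))) (sym (+-assoc (F zero) _ _))

pos-ΣFin : ∀ k (f : Fin k → ℕ) → + ΣFin k f ≡ ∑[ i < k ] (+ f i)
pos-ΣFin zero    f = refl
pos-ΣFin (suc k) f = trans (pos-+ (f zero) _) (cong (_+_ (+ f zero)) (pos-ΣFin k (f ∘ suc)))

injective⇒surjective : {f : Fin m → Fin m} → Injective _≡_ _≡_ f → ∀ y → ∃ λ x → f x ≡ y
injective⇒surjective {suc m} {f} f-inj y with any? (λ x → f x ≟ y)
... | yes hit = hit
... | no miss = contradiction (injective⇒≤ punchOut-inj) ℕ.1+n≰n
  where
  y≢f : ∀ x → y ≢ f x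
  y≢f x y≡fx = miss (x , sym y≡fx)
  punchOut-inj : Injective _≡_ _≡_ (λ x → punchOut (y≢f x))
  punchOut-inj eq = f-inj (punchOut-injective (y≢f _) (y≢f _) eq)

∑-reindex : {f : Fin m → Fin m} → Injective _≡_ _≡_ f →
            (F : Fin m → ℤ) → sum F ≡ ∑[ i < m ] F (f i)
∑-reindex {m} {f} f-inj F = ∑-permute F (permutation f f⁻¹ f∘f⁻¹ (λ x → f-inj (f∘f⁻¹ (f x))))
  where
  f⁻¹ : Fin m → Fin m
  f⁻¹ y = proj₁ (injective⇒surjective f-inj y)
  f∘f⁻¹ : ∀ y → f (f⁻¹ y) ≡ y
  f∘f⁻¹ y = proj₂ (injective⇒surjective f-inj y)

split∑ : ∀ k (h : Fin k → ℕ) → Fin (ΣFin k h) → Σ[ p ∈ Fin k ] Fin (h p)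
split∑ (suc k) h t with splitAt (h zero) t
... | inj₁ i = zero , i
... | inj₂ t = map suc id (split∑ k (h ∘ suc) t)

join∑ : ∀ k (h : Fin k → ℕ) → Σ[ p ∈ Fin k ] Fin (h p) → Fin (ΣFin k h)
join∑ (suc k) h (zero  , i) = i ↑ˡ ΣFin k (h ∘ suc)
join∑ (suc k) h (suc p , i) = h zero ↑ʳ join∑ k (h ∘ suc) (p , i)

join∑-split∑ : ∀ k (h : Fin k → ℕ) t → join∑ k h (split∑ k h t) ≡ t
join∑-split∑ (suc k) h t with splitAt (h zero) t in eq
... | inj₁ i  = trans (cong (join _ _) (sym eq)) (join-splitAt (h zero) _ t)
... | inj₂ t′ = trans (cong (h zero ↑ʳ_) (join∑-split∑ k (h ∘ suc) t′))
                      (trans (cong (join _ _) (sym eq)) (join-splitAt (h zero) _ t))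

split∑-injective : ∀ k (h : Fin k → ℕ) → Injective _≡_ _≡_ (split∑ k h)
split∑-injective k h {t} {t′} eq =
  trans (sym (join∑-split∑ k h t)) (trans (cong (join∑ k h) eq) (join∑-split∑ k h t′))

split∑-↑ˡ : ∀ k (h : Fin (suc k) → ℕ) i → split∑ (suc k) h (i ↑ˡ ΣFin k (h ∘ suc)) ≡ (zero , i)
split∑-↑ˡ k h i rewrite splitAt-↑ˡ (h zero) i (ΣFin k (h ∘ suc)) = refl

split∑-↑ʳ : ∀ k (h : Fin (suc k) → ℕ) t →
            split∑ (suc k) h (h zero ↑ʳ t) ≡ map suc id (split∑ k (h ∘ suc) t)
split∑-↑ʳ k h t rewrite splitAt-↑ʳ (h zero) (ΣFin k (h ∘ suc)) t = refl

∑-split∑ : ∀ k (h : Fin k → ℕ) (G : Σ[ p ∈ Fin k ] Fin (h p) → ℤ) →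
           ∑[ t < ΣFin k h ] G (split∑ k h t) ≡ ∑[ p < k ] ∑[ i < h p ] G (p , i)
∑-split∑ zero    h G = refl
∑-split∑ (suc k) h G = trans (∑-↑ (h zero) _ (G ∘ split∑ (suc k) h)) (cong₂ _+_
  (sum-cong-≗ λ i → cong G (split∑-↑ˡ k h i))
  (trans (sum-cong-≗ λ t → cong G (split∑-↑ʳ k h t)) (∑-split∑ k (h ∘ suc) (G ∘ map suc id))))

weighted : (h : Fin k → ℕ) → (Fin k → ℤ) → ℤ
weighted {k} h f = ∑[ p < k ] (+ h p * f p)

form : (h : Fin k → ℕ) → (Fin k → Fin k → ℤ) → ℤ
form h U = weighted h (λ p → weighted h (U p))

diagonal : (h : Fin k → ℕ) → (Fin k → Fin k → ℤ) → ℤ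
diagonal h U = weighted h (λ p → + h p * U p p)

infixl 6 _⊕_ _⊖_
infixl 7 _⊗_

_⊕_ _⊖_ : (Fin k → Fin k → ℤ) → (Fin k → Fin k → ℤ) → Fin k → Fin k → ℤ
(U ⊕ V) p q = U p q + V p q
(U ⊖ V) p q = U p q - V p q

_⊗_ : (Fin k → ℤ) → (Fin k → ℤ) → Fin k → Fin k → ℤ
(f ⊗ g) p q = f p * g q

weighted-cong : (h : Fin k → ℕ) {f g : Fin k → ℤ} → (∀ p → f p ≡ g p) → weighted h f ≡ weighted h g
weighted-cong h f≡g = sum-cong-≗ λ p → cong (+ h p *_) (f≡g p)

weighted-+ : (h : Fin k → ℕ) (f g : Fin k → ℤ) →
             weighted h (λ p → f p + g p) ≡ weighted h f + weighted h g
weighted-+ h f g = trans (sum-cong-≗ λ p → *-distribˡ-+ (+ h p) (f p) (g p))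
                         (∑-distrib-+ (λ p → + h p * f p) (λ p → + h p * g p))

weighted-- : (h : Fin k → ℕ) (f g : Fin k → ℤ) →
             weighted h (λ p → f p - g p) ≡ weighted h f - weighted h g
weighted-- h f g = trans (sum-cong-≗ λ p → distrib (+ h p) (f p) (g p))
                         (∑-distrib-- (λ p → + h p * f p) (λ p → + h p * g p))
  where
  distrib : ∀ w x y → w * (x - y) ≡ w * x - w * y
  distrib = solve-∀

weighted-*ˡ : (h : Fin k → ℕ) (c : ℤ) (f : Fin k → ℤ) →
              weighted h (λ p → c * f p) ≡ c * weighted h f
weighted-*ˡ h c f = trans (sum-cong-≗ λ p → x∙yz≈y∙xz (+ h p) c (f p))
                          (sym (*-distribˡ-sum c (λ p → + h p * f p)))

form-+ : (h : Fin k → ℕ) (U V : Fin k → Fin k → ℤ) → form h (U ⊕ V) ≡ form h U + form h V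
form-+ h U V = trans (weighted-cong h λ p → weighted-+ h (U p) (V p))
                     (weighted-+ h (λ p → weighted h (U p)) (λ p → weighted h (V p)))

form-- : (h : Fin k → ℕ) (U V : Fin k → Fin k → ℤ) → form h (U ⊖ V) ≡ form h U - form h V
form-- h U V = trans (weighted-cong h λ p → weighted-- h (U p) (V p))
                     (weighted-- h (λ p → weighted h (U p)) (λ p → weighted h (V p)))

form-⊗ : (h : Fin k → ℕ) (f g : Fin k → ℤ) → form h (f ⊗ g) ≡ weighted h f * weighted h g
form-⊗ {k} h f g = begin
  ∑[ p < k ] (+ h p * weighted h (λ q → f p * g q))
    ≡⟨ sum-cong-≗ (λ p → cong (+ h p *_) (weighted-*ˡ h (f p) g)) ⟩
  ∑[ p < k ] (+ h p * (f p * weighted h g))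
    ≡⟨ sum-cong-≗ (λ p → *-assoc (+ h p) (f p) (weighted h g)) ⟨
  ∑[ p < k ] (+ h p * f p * weighted h g)
    ≡⟨ *-distribʳ-sum (weighted h g) (λ p → + h p * f p) ⟨
  weighted h f * weighted h g ∎
  where open ≡-Reasoning

form-transpose : (h : Fin k → ℕ) (U : Fin k → Fin k → ℤ) → form h (flip U) ≡ form h U
form-transpose {k} h U = begin
  ∑[ p < k ] (+ h p * ∑[ q < k ] (+ h q * U q p))
    ≡⟨ sum-cong-≗ (λ p → *-distribˡ-sum (+ h p) (λ q → + h q * U q p)) ⟩
  ∑[ p < k ] ∑[ q < k ] (+ h p * (+ h q * U q p))
    ≡⟨ ∑-comm (λ p q → + h p * (+ h q * U q p)) ⟩
  ∑[ q < k ] ∑[ p < k ] (+ h p * (+ h q * U q p))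
    ≡⟨ sum-cong-≗ (λ q → sum-cong-≗ λ p → x∙yz≈y∙xz (+ h p) (+ h q) (U q p)) ⟩
  ∑[ q < k ] ∑[ p < k ] (+ h q * (+ h p * U q p))
    ≡⟨ sum-cong-≗ (λ q → *-distribˡ-sum (+ h q) (λ p → + h p * U q p)) ⟨
  ∑[ q < k ] (+ h q * ∑[ p < k ] (+ h p * U q p)) ∎
  where open ≡-Reasoning

record HasFibreSizes (h : Fin k → ℕ) (owner : Fin m → Fin k) : Set where
  field ∑-fibres : ∀ φ → ∑[ r < m ] φ (owner r) ≡ weighted h φ
open HasFibreSizes

∑-owners : {h : Fin k → ℕ} {o₁ o₂ : Fin m → Fin k} → HasFibreSizes h o₁ → HasFibreSizes h o₂ →
           ∀ V → ∑[ r < m ] ∑[ c < m ] V (o₁ r) (o₂ c) ≡ form h V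
∑-owners {h = h} {o₁} fib₁ fib₂ V =
  trans (sum-cong-≗ λ r → ∑-fibres fib₂ (V (o₁ r))) (∑-fibres fib₁ (λ p → weighted h (V p)))

module Partition {k} (h : Fin k → ℕ)
  (emb : (p : Fin k) → Fin (h p) → Fin (ΣFin k h))
  (emb-injective : ∀ p → Injective _≡_ _≡_ (emb p))
  (emb-disjoint : ∀ p q → p ≢ q → ∀ i j → emb p i ≢ emb q j) where

  emb′ : Σ[ p ∈ Fin k ] Fin (h p) → Fin (ΣFin k h)
  emb′ (p , i) = emb p i

  emb′-injective : Injective _≡_ _≡_ emb′
  emb′-injective {p , i} {q , j} eq with p ≟ q
  ... | yes refl = cong (p ,_) (emb-injective p eq)
  ... | no p≢q   = contradiction eq (emb-disjoint p q p≢q i j)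

  enumeration-injective : Injective _≡_ _≡_ (emb′ ∘ split∑ k h)
  enumeration-injective = split∑-injective k h ∘ emb′-injective

  emb′-surjective : ∀ r → ∃ λ x → emb′ x ≡ r
  emb′-surjective r = let t , eq = injective⇒surjective enumeration-injective r in split∑ k h t , eq

  ∑-partition : (F : Fin (ΣFin k h) → ℤ) → sum F ≡ ∑[ p < k ] ∑[ i < h p ] F (emb p i)
  ∑-partition F = trans (∑-reindex enumeration-injective F) (∑-split∑ k h (F ∘ emb′))

  owner : Fin (ΣFin k h) → Fin k
  owner r = proj₁ (proj₁ (emb′-surjective r))

  owner-emb : ∀ p i → owner (emb p i) ≡ p
  owner-emb p i = cong proj₁ (emb′-injective (proj₂ (emb′-surjective (emb p i))))

  owner-fibres : HasFibreSizes h owner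
  owner-fibres .∑-fibres φ = trans (∑-partition (φ ∘ owner)) (sum-cong-≗ λ p →
    trans (sum-cong-≗ λ i → cong φ (owner-emb p i)) (∑-const (h p) (φ p)))

∑∑-distrib-+ : (F G : Fin m → Fin m → ℤ) →
  ∑[ r < m ] ∑[ c < m ] (F r c + G r c) ≡ ∑[ r < m ] ∑[ c < m ] F r c + ∑[ r < m ] ∑[ c < m ] G r c
∑∑-distrib-+ F G = trans (sum-cong-≗ λ r → ∑-distrib-+ (F r) (G r))
                         (∑-distrib-+ (λ r → sum (F r)) (λ r → sum (G r)))

i+i+i≡3*i : ∀ i → i + i + i ≡ + 3 * i
i+i+i≡3*i = solve-∀

module CyclicCount {k} {h : Fin k → ℕ} {L : Square (ΣFin k h)} (latin : IsLatin L)
  (sq : (p : Fin k) → Subsquare L (h p))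
  (disjoint : ∀ p q → p ≢ q → DisjointSub (sq p) (sq q)) where

  private
    n : ℕ
    n = ΣFin k h
    module R = Partition h (rows ∘ sq) (rows-inj ∘ sq) (λ p q p≢q → proj₁ (disjoint p q p≢q))
    module C = Partition h (cols ∘ sq) (cols-inj ∘ sq) (λ p q p≢q → proj₁ (proj₂ (disjoint p q p≢q)))
    module S = Partition h (syms ∘ sq) (syms-inj ∘ sq) (λ p q p≢q → proj₂ (proj₂ (disjoint p q p≢q)))

  cyclic : (Fin k → Fin k → ℤ) → Fin n → Fin n → ℤ
  cyclic U r c = U (R.owner r) (C.owner c) + U (C.owner c) (S.owner (L r c)) + U (S.owner (L r c)) (R.owner r)

  ∑-rows-cols : (V : Fin k → Fin k → ℤ) →
                ∑[ r < n ] ∑[ c < n ] V (R.owner r) (C.owner c) ≡ form h V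
  ∑-rows-cols = ∑-owners R.owner-fibres C.owner-fibres

  ∑-cols-syms : (V : Fin k → Fin k → ℤ) →
                ∑[ r < n ] ∑[ c < n ] V (C.owner c) (S.owner (L r c)) ≡ form h V
  ∑-cols-syms V = begin
    ∑[ r < n ] ∑[ c < n ] V (C.owner c) (S.owner (L r c))
      ≡⟨ ∑-comm (λ r c → V (C.owner c) (S.owner (L r c))) ⟩
    ∑[ c < n ] ∑[ r < n ] V (C.owner c) (S.owner (L r c))
      ≡⟨ sum-cong-≗ (λ c → ∑-reindex (proj₂ latin c) (V (C.owner c) ∘ S.owner)) ⟨
    ∑[ c < n ] ∑[ σ < n ] V (C.owner c) (S.owner σ)
      ≡⟨ ∑-owners C.owner-fibres S.owner-fibres V ⟩
    form h V ∎
    where open ≡-Reasoning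

  ∑-syms-rows : (V : Fin k → Fin k → ℤ) →
                ∑[ r < n ] ∑[ c < n ] V (S.owner (L r c)) (R.owner r) ≡ form h V
  ∑-syms-rows V = begin
    ∑[ r < n ] ∑[ c < n ] V (S.owner (L r c)) (R.owner r)
      ≡⟨ sum-cong-≗ (λ r → ∑-reindex (proj₁ latin r) (λ σ → V (S.owner σ) (R.owner r))) ⟨
    ∑[ r < n ] ∑[ σ < n ] V (S.owner σ) (R.owner r)
      ≡⟨ ∑-owners R.owner-fibres S.owner-fibres (flip V) ⟩
    form h (flip V)
      ≡⟨ form-transpose h V ⟩
    form h V ∎
    where open ≡-Reasoning

  ∑-cyclic : (U : Fin k → Fin k → ℤ) → ∑[ r < n ] ∑[ c < n ] cyclic U r c ≡ + 3 * form h U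
  ∑-cyclic U = begin
    ∑[ r < n ] ∑[ c < n ] cyclic U r c
      ≡⟨ ∑∑-distrib-+ (λ r c → U (R.owner r) (C.owner c) + U (C.owner c) (S.owner (L r c)))
                      (λ r c → U (S.owner (L r c)) (R.owner r)) ⟩
    ∑[ r < n ] ∑[ c < n ] (U (R.owner r) (C.owner c) + U (C.owner c) (S.owner (L r c)))
      + ∑[ r < n ] ∑[ c < n ] U (S.owner (L r c)) (R.owner r)
      ≡⟨ cong₂ _+_ (∑∑-distrib-+ (λ r c → U (R.owner r) (C.owner c))
                                 (λ r c → U (C.owner c) (S.owner (L r c))))
                   (∑-syms-rows U) ⟩
    ∑[ r < n ] ∑[ c < n ] U (R.owner r) (C.owner c)
      + ∑[ r < n ] ∑[ c < n ] U (C.owner c) (S.owner (L r c)) + form h U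
      ≡⟨ cong (_+ form h U) (cong₂ _+_ (∑-rows-cols U) (∑-cols-syms U)) ⟩
    form h U + form h U + form h U
      ≡⟨ i+i+i≡3*i (form h U) ⟩
    + 3 * form h U ∎
    where open ≡-Reasoning

  cyclic-subsquare : (U : Fin k → Fin k → ℤ) (p : Fin k) (i j : Fin (h p)) →
                     cyclic U (rows (sq p) i) (cols (sq p) j) ≡ U p p + U p p + U p p
  cyclic-subsquare U p i j
    rewrite R.owner-emb p i | C.owner-emb p j | entry-ok (sq p) i j
          | S.owner-emb p (entry (sq p) i j) = refl

  ∑-cyclic-subsquare : (U : Fin k → Fin k → ℤ) (p : Fin k) →
    ∑[ i < h p ] ∑[ j < h p ] cyclic U (rows (sq p) i) (cols (sq p) j) ≡ + h p * (+ 3 * (+ h p * U p p))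
  ∑-cyclic-subsquare U p = begin
    ∑[ i < h p ] ∑[ j < h p ] cyclic U (rows (sq p) i) (cols (sq p) j)
      ≡⟨ sum-cong-≗ (λ i → sum-cong-≗ λ j → trans (cyclic-subsquare U p i j) (i+i+i≡3*i (U p p))) ⟩
    ∑[ i < h p ] ∑[ j < h p ] (+ 3 * U p p)
      ≡⟨ sum-cong-≗ {h p} (λ i → ∑-const (h p) (+ 3 * U p p)) ⟩
    ∑[ i < h p ] (+ h p * (+ 3 * U p p))
      ≡⟨ ∑-const (h p) (+ h p * (+ 3 * U p p)) ⟩
    + h p * (+ h p * (+ 3 * U p p))
      ≡⟨ cong (+ h p *_) (x∙yz≈y∙xz (+ h p) (+ 3) (U p p)) ⟩
    + h p * (+ 3 * (+ h p * U p p)) ∎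
    where open ≡-Reasoning

  ∑-subsquares-≤ : (T : Fin n → Fin n → ℤ) → (∀ r c → 0ℤ ℤ.≤ T r c) →
    ∑[ p < k ] ∑[ i < h p ] ∑[ j < h p ] T (rows (sq p) i) (cols (sq p) j) ℤ.≤ ∑[ r < n ] ∑[ c < n ] T r c
  ∑-subsquares-≤ T 0≤T = begin
    ∑[ p < k ] ∑[ i < h p ] ∑[ j < h p ] T (rows (sq p) i) (cols (sq p) j)
      ≤⟨ ∑-mono-≤ (λ p → ∑-mono-≤ λ i →
           term≤∑ (λ q → ∑-nonneg λ j → 0≤T (rows (sq p) i) (cols (sq q) j)) p) ⟩
    ∑[ p < k ] ∑[ i < h p ] ∑[ q < k ] ∑[ j < h q ] T (rows (sq p) i) (cols (sq q) j)
      ≡⟨ sum-cong-≗ (λ p → sum-cong-≗ λ i → C.∑-partition (T (rows (sq p) i))) ⟨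
    ∑[ p < k ] ∑[ i < h p ] ∑[ c < n ] T (rows (sq p) i) c
      ≡⟨ R.∑-partition (λ r → sum (T r)) ⟨
    ∑[ r < n ] ∑[ c < n ] T r c ∎
    where open ≤-Reasoning

  diagonal≤form : (U : Fin k → Fin k → ℤ) → (∀ r c → 0ℤ ℤ.≤ cyclic U r c) →
                  diagonal h U ℤ.≤ form h U
  diagonal≤form U 0≤cyclic = *-cancelˡ-≤-pos (diagonal h U) (form h U) (+ 3) (begin
    + 3 * diagonal h U
      ≡⟨ weighted-*ˡ h (+ 3) (λ p → + h p * U p p) ⟨
    ∑[ p < k ] (+ h p * (+ 3 * (+ h p * U p p)))
      ≡⟨ sum-cong-≗ (∑-cyclic-subsquare U) ⟨
    ∑[ p < k ] ∑[ i < h p ] ∑[ j < h p ] cyclic U (rows (sq p) i) (cols (sq p) j)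
      ≤⟨ ∑-subsquares-≤ (cyclic U) 0≤cyclic ⟩
    ∑[ r < n ] ∑[ c < n ] cyclic U r c
      ≡⟨ ∑-cyclic U ⟩
    + 3 * form h U ∎)
    where open ≤-Reasoning

LS⇒diagonal≤form : {h : Fin k → ℕ} → LS k h → (U : Fin k → Fin k → ℤ) →
                   (∀ p q s → 0ℤ ℤ.≤ U p q + U q s + U s p) → diagonal h U ℤ.≤ form h U
LS⇒diagonal≤form (L , latin , sq , disjoint) U 0≤cyclic = diagonal≤form U (λ r c → 0≤cyclic _ _ _)
  where open CyclicCount latin sq disjoint

𝟙 : Bool → ℤ
𝟙 b = if b then 1ℤ else 0ℤ

pos-if : ∀ b n → + (if b then n else 0) ≡ + n * 𝟙 b
pos-if true  n = sym (*-identityʳ (+ n))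
pos-if false n = sym (*-zeroʳ (+ n))

pos-ΣOver : (S : Subset k) (f : Fin k → ℕ) → + ΣOver S f ≡ weighted f (λ p → 𝟙 (lookup S p))
pos-ΣOver {k} S f = trans (pos-ΣFin k _) (sum-cong-≗ λ p → pos-if (lookup S p) (f p))

lookup-∪ : (X Y : Subset k) (p : Fin k) → lookup (X ∪ Y) p ≡ lookup X p ∨ lookup Y p
lookup-∪ X Y p = lookup-zipWith _∨_ p X Y

weighted-∪ : (h : Fin k → ℕ) (X Y : Subset k) →
             weighted h (λ p → 𝟙 (lookup X p ∨ lookup Y p)) ≡ + ΣOver (X ∪ Y) h
weighted-∪ h X Y = sym (trans (pos-ΣOver (X ∪ Y) h) (weighted-cong h λ p → cong 𝟙 (lookup-∪ X Y p)))

disjoint-lookup : {X Y : Subset k} → DisjointSets X Y → ∀ p → lookup X p ∧ lookup Y p ≡ false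
disjoint-lookup {X = X} {Y} X∩Y≡∅ p with lookup X p in X∋p | lookup Y p in Y∋p
... | true  | true  = contradiction (lookup⇒[]= p Y Y∋p) (X∩Y≡∅ p (lookup⇒[]= p X X∋p))
... | true  | false = refl
... | false | _     = refl

-- Whether an index lies in A, B, C, D, in this order.
Membership : Set
Membership = Bool × Bool × Bool × Bool

kernel : Membership → Membership → ℤ
kernel (a , b , c , d) (a′ , b′ , c′ , d′) =
  𝟙 (a ∨ c) * 𝟙 (a′ ∨ c′) + 𝟙 (b ∨ d) * 𝟙 (b′ ∨ d′)
    + 𝟙 (a ∨ d) * 𝟙 (not (a′ ∨ b′ ∨ c′ ∨ d′)) - 𝟙 (b ∨ c) * 𝟙 (a′ ∨ d′)

admissible : List Membership
admissible = (true  , false , false , false)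
           ∷ (false , true  , false , false)
           ∷ (false , false , true  , false)
           ∷ (false , false , false , true)
           ∷ (false , false , false , false)
           ∷ []

pairwise-disjoint⇒admissible : ∀ {a b c d} → a ∧ b ≡ false → a ∧ c ≡ false → a ∧ d ≡ false →
  b ∧ c ≡ false → b ∧ d ≡ false → c ∧ d ≡ false → (a , b , c , d) ∈ admissible
pairwise-disjoint⇒admissible {true}  {false} {false} {false} _ _ _ _ _ _ = here refl
pairwise-disjoint⇒admissible {false} {true}  {false} {false} _ _ _ _ _ _ = there (here refl)
pairwise-disjoint⇒admissible {false} {false} {true}  {false} _ _ _ _ _ _ = there (there (here refl))
pairwise-disjoint⇒admissible {false} {false} {false} {true}  _ _ _ _ _ _ =
  there (there (there (here refl)))
pairwise-disjoint⇒admissible {false} {false} {false} {false} _ _ _ _ _ _ =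
  there (there (there (there (here refl))))
pairwise-disjoint⇒admissible {true}  {true}                () _ _ _ _ _
pairwise-disjoint⇒admissible {true}  {false} {true}        _ () _ _ _ _
pairwise-disjoint⇒admissible {true}  {false} {false} {true} _ _ () _ _ _
pairwise-disjoint⇒admissible {false} {true}  {true}        _ _ _ () _ _
pairwise-disjoint⇒admissible {false} {true}  {false} {true} _ _ _ _ () _
pairwise-disjoint⇒admissible {false} {false} {true}  {true} _ _ _ _ _ ()

kernel-cyclic : All (λ x → All (λ y → All (λ z → 0ℤ ℤ.≤ kernel x y + kernel y z + kernel z x)
                  admissible) admissible) admissible
kernel-cyclic = from-yes (all? (λ x → all? (λ y → all? (λ z →
                  0ℤ ℤ.≤? kernel x y + kernel y z + kernel z x) admissible) admissible) admissible)

kernel-diagonal : All (λ x → let (a , b , c , d) = x in kernel x x ≡ 𝟙 (a ∨ b ∨ c ∨ d)) admissible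
kernel-diagonal = refl ∷ refl ∷ refl ∷ refl ∷ refl ∷ []

module Quadrants {k} (A B C D : Subset k) where

  membership : Fin k → Membership
  membership p = lookup A p , lookup B p , lookup C p , lookup D p

  U : Fin k → Fin k → ℤ
  U p q = kernel (membership p) (membership q)

  membership-admissible : DisjointSets A B → DisjointSets A C → DisjointSets A D →
    DisjointSets B C → DisjointSets B D → DisjointSets C D → ∀ p → membership p ∈ admissible
  membership-admissible A∩B A∩C A∩D B∩C B∩D C∩D p = pairwise-disjoint⇒admissible
    (disjoint-lookup A∩B p) (disjoint-lookup A∩C p) (disjoint-lookup A∩D p)
    (disjoint-lookup B∩C p) (disjoint-lookup B∩D p) (disjoint-lookup C∩D p)

  U-cyclic : (∀ p → membership p ∈ admissible) → ∀ p q s → 0ℤ ℤ.≤ U p q + U q s + U s p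
  U-cyclic adm p q s = All.lookup (All.lookup (All.lookup kernel-cyclic (adm p)) (adm q)) (adm s)

  lookup-E : ∀ p → lookup (A ∪ B ∪ C ∪ D) p ≡ lookup A p ∨ lookup B p ∨ lookup C p ∨ lookup D p
  lookup-E p = trans (lookup-∪ A _ p) (cong (lookup A p ∨_)
                 (trans (lookup-∪ B _ p) (cong (lookup B p ∨_) (lookup-∪ C D p))))

  diagonal-U : (∀ p → membership p ∈ admissible) → (h : Fin k → ℕ) →
               diagonal h U ≡ + ΣOver (A ∪ B ∪ C ∪ D) (λ i → h i ℕ.* h i)
  diagonal-U adm h = sym (trans (pos-ΣOver (A ∪ B ∪ C ∪ D) (λ i → h i ℕ.* h i)) (sum-cong-≗ λ p → begin
    + (h p ℕ.* h p) * 𝟙 (lookup (A ∪ B ∪ C ∪ D) p)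
      ≡⟨ cong₂ _*_ (pos-* (h p) (h p)) (cong 𝟙 (lookup-E p)) ⟩
    + h p * + h p * 𝟙 (lookup A p ∨ lookup B p ∨ lookup C p ∨ lookup D p)
      ≡⟨ *-assoc (+ h p) (+ h p) _ ⟩
    + h p * (+ h p * 𝟙 (lookup A p ∨ lookup B p ∨ lookup C p ∨ lookup D p))
      ≡⟨ cong (λ x → + h p * (+ h p * x)) (All.lookup kernel-diagonal (adm p)) ⟨
    + h p * (+ h p * U p p) ∎))
    where open ≡-Reasoning

  indicator : (Bool → Bool → Bool → Bool → Bool) → Fin k → ℤ
  indicator φ p = 𝟙 (φ (lookup A p) (lookup B p) (lookup C p) (lookup D p))

  𝟙AC 𝟙BD 𝟙AD 𝟙BC 𝟙∁E : Fin k → ℤ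
  𝟙AC = indicator λ a b c d → a ∨ c
  𝟙BD = indicator λ a b c d → b ∨ d
  𝟙AD = indicator λ a b c d → a ∨ d
  𝟙BC = indicator λ a b c d → b ∨ c
  𝟙∁E = indicator λ a b c d → not (a ∨ b ∨ c ∨ d)

  form-U-expand : (h : Fin k → ℕ) →
    form h U ≡ weighted h 𝟙AC * weighted h 𝟙AC + weighted h 𝟙BD * weighted h 𝟙BD
               + weighted h 𝟙AD * weighted h 𝟙∁E - weighted h 𝟙BC * weighted h 𝟙AD
  form-U-expand h = begin
    form h (𝟙AC ⊗ 𝟙AC ⊕ 𝟙BD ⊗ 𝟙BD ⊕ 𝟙AD ⊗ 𝟙∁E ⊖ 𝟙BC ⊗ 𝟙AD)
      ≡⟨ form-- h (𝟙AC ⊗ 𝟙AC ⊕ 𝟙BD ⊗ 𝟙BD ⊕ 𝟙AD ⊗ 𝟙∁E) (𝟙BC ⊗ 𝟙AD) ⟩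
    form h (𝟙AC ⊗ 𝟙AC ⊕ 𝟙BD ⊗ 𝟙BD ⊕ 𝟙AD ⊗ 𝟙∁E) - form h (𝟙BC ⊗ 𝟙AD)
      ≡⟨ cong (_- form h (𝟙BC ⊗ 𝟙AD)) (form-+ h (𝟙AC ⊗ 𝟙AC ⊕ 𝟙BD ⊗ 𝟙BD) (𝟙AD ⊗ 𝟙∁E)) ⟩
    form h (𝟙AC ⊗ 𝟙AC ⊕ 𝟙BD ⊗ 𝟙BD) + form h (𝟙AD ⊗ 𝟙∁E) - form h (𝟙BC ⊗ 𝟙AD)
      ≡⟨ cong (λ x → x + form h (𝟙AD ⊗ 𝟙∁E) - form h (𝟙BC ⊗ 𝟙AD)) (form-+ h (𝟙AC ⊗ 𝟙AC) (𝟙BD ⊗ 𝟙BD)) ⟩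
    form h (𝟙AC ⊗ 𝟙AC) + form h (𝟙BD ⊗ 𝟙BD) + form h (𝟙AD ⊗ 𝟙∁E) - form h (𝟙BC ⊗ 𝟙AD)
      ≡⟨ cong₂ _-_ (cong₂ _+_ (cong₂ _+_ (form-⊗ h 𝟙AC 𝟙AC) (form-⊗ h 𝟙BD 𝟙BD)) (form-⊗ h 𝟙AD 𝟙∁E))
                   (form-⊗ h 𝟙BC 𝟙AD) ⟩
    weighted h 𝟙AC * weighted h 𝟙AC + weighted h 𝟙BD * weighted h 𝟙BD
      + weighted h 𝟙AD * weighted h 𝟙∁E - weighted h 𝟙BC * weighted h 𝟙AD ∎
    where open ≡-Reasoning

  weighted-∁E : (h : Fin k → ℕ) → weighted h 𝟙∁E ≡ + ΣOver (∁ (A ∪ B ∪ C ∪ D)) h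
  weighted-∁E h = sym (trans (pos-ΣOver (∁ (A ∪ B ∪ C ∪ D)) h) (weighted-cong h λ p →
    cong 𝟙 (trans (lookup-map p not (A ∪ B ∪ C ∪ D)) (cong not (lookup-E p)))))

  form-U : (h : Fin k → ℕ) → let s = λ S → + ΣOver S h in
    form h U ≡ s (A ∪ C) * s (A ∪ C) + s (B ∪ D) * s (B ∪ D) + s (A ∪ D) * s (∁ (A ∪ B ∪ C ∪ D))
               - s (B ∪ C) * s (A ∪ D)
  form-U h = trans (form-U-expand h)
    (cong₂ _-_ (cong₂ _+_ (cong₂ _+_ (cong₂ _*_ (weighted-∪ h A C) (weighted-∪ h A C))
                                     (cong₂ _*_ (weighted-∪ h B D) (weighted-∪ h B D)))
                          (cong₂ _*_ (weighted-∪ h A D) (weighted-∁E h)))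
               (cong₂ _*_ (weighted-∪ h B C) (weighted-∪ h A D)))

rearrange : ∀ x y u v e {d} → d ℤ.≤ x * x + y * y + u * e - v * u → x * x + y * y - d ≥ u * (v - e)
rearrange x y u v e {d} d≤ = begin
  u * (v - e)                                        ≡⟨ +-identityʳ (u * (v - e)) ⟨
  u * (v - e) + 0ℤ                                   ≤⟨ +-monoʳ-≤ (u * (v - e)) (i≤j⇒0≤j-i d≤) ⟩
  u * (v - e) + (x * x + y * y + u * e - v * u - d)  ≡⟨ regroup x y u v e d ⟩
  x * x + y * y - d                                  ∎
  where
  open ≤-Reasoning
  regroup : ∀ x y u v e d → u * (v - e) + (x * x + y * y + u * e - v * u - d) ≡ x * x + y * y - d
  regroup = solve-∀

mainTheorem2 : (k : ℕ) (h : Fin k → ℕ) → ((i : Fin k) → 1 ≤ h i) → LS k h →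
    (A B C D : Subset k) →
    DisjointSets A B → DisjointSets A C → DisjointSets A D →
    DisjointSets B C → DisjointSets B D → DisjointSets C D →
    let E = A ∪ B ∪ C ∪ D
        s = λ (S : Subset k) → + ΣOver S h
    in s (A ∪ C) * s (A ∪ C) + s (B ∪ D) * s (B ∪ D)
         - (+ ΣOver E (λ i → h i Data.Nat.* h i))
       ≥ s (A ∪ D) * (s (B ∪ C) - s (∁ E))
mainTheorem2 k h _ ls A B C D A∩B A∩C A∩D B∩C B∩D C∩D =
  rearrange (s (A ∪ C)) (s (B ∪ D)) (s (A ∪ D)) (s (B ∪ C)) (s (∁ E)) (begin
    + ΣOver E (λ i → h i Data.Nat.* h i)  ≡⟨ diagonal-U adm h ⟨
    diagonal h U                          ≤⟨ LS⇒diagonal≤form ls U (U-cyclic adm) ⟩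
    form h U                              ≡⟨ form-U h ⟩
    s (A ∪ C) * s (A ∪ C) + s (B ∪ D) * s (B ∪ D) + s (A ∪ D) * s (∁ E) - s (B ∪ C) * s (A ∪ D) ∎)
  where
  open Quadrants A B C D
  open ≤-Reasoning
  E : Subset k
  E = A ∪ B ∪ C ∪ D
  s : Subset k → ℤ
  s S = + ΣOver S h
  adm : ∀ p → membership p ∈ admissible
  adm = membership-admissible A∩B A∩C A∩D B∩C B∩D C∩D
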